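{- Let $G$ be a connected graph and $n\ge 1$. Then B wins the gp achievement game on $G\circ K_n$ if and only if either B wins the gp achievement game on $G$ or $n$ is even.
   Context: A general position set of a graph $G$ is a set $S\subseteq V(G)$ such that no three vertices of $S$ lie on a common shortest path of $G$. The gp achievement game on a graph: players A and B alternately select vertices, A first; a selection is legal if the vertex has not been selected before and the set of all vertices selected so far (including it) is a general position set. The game ends when no legal move exists, and the player who selected the last vertex wins; "a player wins the game" means that player has a winning strategy. The lexicographic product $G\circ H$ has vertex set $V(G)\times V(H)$, with $(g,h)$ adjacent to $(g',h')$ iff either $gg'\in E(G)$, or $g=g'$ and $hh'\in E(H)$. $K_n$ is the complete graph on $n$ vertices. -}

module Defs where

open import Level using (0ℓ)
open import Data.Nat using (ℕ; _≤_)
open import Data.Fin using (Fin)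
open import Data.List using (List; []; _∷_; length)
open import Data.List.Membership.Propositional using (_∈_; _∉_)
open import Data.Product using (Σ; ∃; _×_; _,_)
open import Data.Sum using (_⊎_; inj₁; inj₂)
open import Relation.Nullary using (¬_)
open import Relation.Binary.PropositionalEquality using (_≡_; _≢_; refl; sym)

record Graph : Set₁ where
  field
    Vertex : Set
    _~_    : Vertex → Vertex → Set
    ~-sym  : ∀ {u v} → u ~ v → v ~ u
    ~-irr  : ∀ {v} → ¬ (v ~ v)

module _ (G : Graph) where
  open Graph G

  Finite : Set
  Finite = Σ (List Vertex) λ vs → ∀ v → v ∈ vs

  data Walk : Vertex → Vertex → List Vertex → Set where
    here : ∀ {v} → Walk v v (v ∷ [])
    step : ∀ {u w v ws} → u ~ w → Walk w v ws → Walk u v (u ∷ ws)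

  Connected : Set
  Connected = ∀ u v → ∃ λ ws → Walk u v ws

  ShortestPath : Vertex → Vertex → List Vertex → Set
  ShortestPath u v ws =
    Walk u v ws × (∀ ws' → Walk u v ws' → length ws ≤ length ws')

  OnCommonShortestPath : Vertex → Vertex → Vertex → Set
  OnCommonShortestPath x y z =
    ∃ λ u → ∃ λ v → ∃ λ ws → ShortestPath u v ws × x ∈ ws × y ∈ ws × z ∈ ws

  GeneralPosition : List Vertex → Set
  GeneralPosition S = ∀ x y z → x ∈ S → y ∈ S → z ∈ S →
    x ≢ y → y ≢ z → x ≢ z → ¬ OnCommonShortestPath x y z

  Legal : List Vertex → Vertex → Set
  Legal S v = v ∉ S × GeneralPosition (v ∷ S)

  -- gp achievement game: position = list of vertices selected so far.
  -- ToMoveWins S  : the player to move at S has a winning strategy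
  -- ToMoveLoses S : the other player has a winning strategy
  -- (the last player to move wins, i.e. a player with no legal move loses)
  data ToMoveWins (S : List Vertex) : Set
  data ToMoveLoses (S : List Vertex) : Set

  data ToMoveWins S where
    move : ∀ v → Legal S v → ToMoveLoses (v ∷ S) → ToMoveWins S

  data ToMoveLoses S where
    allMoves : (∀ v → Legal S v → ToMoveWins (v ∷ S)) → ToMoveLoses S

  -- A moves first from the empty position; B wins iff A (to move) loses
  AWins : Set
  AWins = ToMoveWins []

  BWins : Set
  BWins = ToMoveLoses []

K : ℕ → Graph
K n = record
  { Vertex = Fin n
  ; _~_ = λ h h' → h ≢ h'
  ; ~-sym = λ p q → p (sym q)
  ; ~-irr = λ p → p refl
  }

_∘ₗ_ : Graph → Graph → Graph
G ∘ₗ H = record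
  { Vertex = G.Vertex × H.Vertex
  ; _~_ = adj
  ; ~-sym = adj-sym
  ; ~-irr = adj-irr
  }
  where
  module G = Graph G
  module H = Graph H
  adj : G.Vertex × H.Vertex → G.Vertex × H.Vertex → Set
  adj (g , h) (g' , h') = (g G.~ g') ⊎ (g ≡ g' × h H.~ h')
  adj-sym : ∀ {u v} → adj u v → adj v u
  adj-sym (inj₁ p) = inj₁ (G.~-sym p)
  adj-sym (inj₂ (refl , q)) = inj₂ (refl , H.~-sym q)
  adj-irr : ∀ {v} → ¬ adj v v
  adj-irr (inj₁ p) = G.~-irr p
  adj-irr (inj₂ (_ , q)) = H.~-irr q

-- Two distinct vertices of a fibre {g} × K_n of G ∘ K_n are true twins, and a
-- geodesic containing two true twins contains no third vertex; three vertices in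
-- pairwise distinct fibres lie on a common geodesic exactly when their
-- projections to G do.  Hence a set is in general position in G ∘ K_n iff its
-- projection is in general position in G: the game on G ∘ K_n is the game on G
-- in which a player may also move inside a fibre that is already occupied.
-- If n is even, B answers every move (g , h) by (g , μ h) for a fixed-point-free
-- involution μ of K_n.  If n is odd, the first vertex (g , h) played in a fibre
-- stands for the move g of the game on G, and the other n - 1 vertices of the
-- fibre are paired by an involution fixing h; whoever wins the game on G plays
-- it on the fibres and answers every other move by its partner.
module Submission where

open import Defs
open import Data.Nat using (ℕ; zero; suc; _≤_; _<_; _*_; s≤s; z≤n)
open import Data.Nat.Properties using (n<1+n; ≤-trans; ≤-reflexive; <-trans; <⇒≱; m≤n⇒m≤1+n; +-comm)
open import Data.Nat.Divisibility using (_∣_; n∣m*n; ∣m+n∣m⇒∣n; ∣1⇒≡1)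
open import Data.Nat.Induction using (<-wellFounded)
open import Induction.WellFounded using (Acc; acc)
open import Data.Fin using (Fin; zero; suc)
import Data.Fin.Properties as Fin
open import Data.Fin.Permutation using (Permutation; transpose; _⟨$⟩ʳ_; _⟨$⟩ˡ_; inverseˡ; inverseʳ)
open import Data.List
  using (List; []; _∷_; _++_; [_]; _∷ʳ_; length; map; cartesianProduct; allFin; initLast; _∷ʳ′_)
open import Data.List.Properties using (length-map; length-++-≤ʳ; ++-assoc)
open import Data.List.Relation.Unary.Any using (here; there; index)
open import Data.List.Membership.Propositional using (_∈_; _∉_)
open import Data.List.Membership.Propositional.Properties
  using (∈-map⁺; ∈-map⁻; ∈-++⁻; ∈-∃++; ∈-allFin; ∈-cartesianProduct⁺)
import Data.List.Membership.Setoid.Properties as SetoidMembership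
import Data.List.Membership.DecPropositional as DecMembership
open import Data.List.Relation.Binary.Subset.Propositional using (_⊆_)
open import Data.List.Relation.Binary.Subset.Propositional.Properties
  using (map⁺; ∷⁺ʳ; ∈-∷⁺ʳ)
open import Data.Product using (∃; _×_; _,_; proj₁; proj₂; map₁; <_,_>)
open import Data.Product.Properties using (≡-dec; ×-≡,≡→≡)
open import Data.Sum using (_⊎_; inj₁; inj₂; [_,_]′)
import Data.Sum as Sum
open import Data.Empty using (⊥; ⊥-elim)
open import Function using (id; const; _∘_)
open import Relation.Nullary using (¬_; Dec; yes; no)
open import Relation.Nullary.Decidable using (map′)
open import Relation.Binary.Definitions using (DecidableEquality)
open import Relation.Binary.PropositionalEquality
  using (_≡_; _≢_; refl; sym; trans; cong; subst; subst₂; setoid; module ≡-Reasoning)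

module Geodesic (G : Graph) where
  open Graph G

  Near : Vertex → Vertex → Set
  Near a b = a ~ b ⊎ a ≡ b

  Near-sym : ∀ {a b} → Near a b → Near b a
  Near-sym (inj₁ a~b) = inj₁ (~-sym a~b)
  Near-sym (inj₂ a≡b) = inj₂ (sym a≡b)

  walk-head : ∀ {u v ws} → Walk G u v ws → u ∈ ws
  walk-head here       = here refl
  walk-head (step _ _) = here refl

  walk-split : ∀ {u v} pre {a} rest → Walk G u v (pre ++ a ∷ rest) →
               Walk G u a (pre ∷ʳ a) × Walk G a v (a ∷ rest)
  walk-split []                rest here       = here , here
  walk-split []                rest (step p w) = here , step p w
  walk-split (_ ∷ [])          rest (step p w) = map₁ (step p) (walk-split [] rest w)
  walk-split (_ ∷ pre@(_ ∷ _)) rest (step p w) = map₁ (step p) (walk-split pre rest w)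

  walk-join : ∀ {u v} pre {a} rest → Walk G u a (pre ∷ʳ a) → Walk G a v (a ∷ rest) →
              Walk G u v (pre ++ a ∷ rest)
  walk-join []                rest here        w₂ = w₂
  walk-join []                rest (step _ ()) w₂
  walk-join (_ ∷ [])          rest (step p w₁) w₂ = step p (walk-join [] rest w₁ w₂)
  walk-join (_ ∷ pre@(_ ∷ _)) rest (step p w₁) w₂ = step p (walk-join pre rest w₁ w₂)

  walk-edge : ∀ {u v} pre {a b} rest → Walk G u v (pre ++ a ∷ b ∷ rest) → a ~ b
  walk-edge pre rest w with proj₂ (walk-split pre _ w)
  ... | step a~b here       = a~b
  ... | step a~b (step _ _) = a~b

  walk-≤2-ends : ∀ {u v ws w} → Walk G u v ws → length ws ≤ 2 → w ∈ ws → w ≡ u ⊎ w ≡ v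
  walk-≤2-ends here                         _              (here refl)         = inj₁ refl
  walk-≤2-ends (step _ here)                _              (here refl)         = inj₁ refl
  walk-≤2-ends (step _ here)                _              (there (here refl)) = inj₂ refl
  walk-≤2-ends (step _ (step _ here))       (s≤s (s≤s ())) _
  walk-≤2-ends (step _ (step _ (step _ _))) (s≤s (s≤s ())) _

  geodesic-near-ends : ∀ {u v ws w} → ShortestPath G u v ws → Near u v → w ∈ ws → w ≡ u ⊎ w ≡ v
  geodesic-near-ends (walk , minimal) (inj₁ u~v)  = walk-≤2-ends walk (minimal _ (step u~v here))
  geodesic-near-ends (walk , minimal) (inj₂ refl) = walk-≤2-ends walk (m≤n⇒m≤1+n (minimal _ here))

  length-++ˡ-< : ∀ (pre : List Vertex) {xs ys} → length xs < length ys →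
                 length (pre ++ xs) < length (pre ++ ys)
  length-++ˡ-< []        lt = lt
  length-++ˡ-< (_ ∷ pre) lt = s≤s (length-++ˡ-< pre lt)

  geodesic-no-shortcut : ∀ {u v} pre {a m b} mid post →
    ShortestPath G u v (pre ++ a ∷ m ∷ mid ++ b ∷ post) → ¬ Near a b
  geodesic-no-shortcut {u} {v} pre {a} {m} {b} mid post (walk , minimal) = λ where
      (inj₁ a~b) → shorter (b ∷ post) (step a~b fromB) skip
      (inj₂ a≡b) → shorter post (subst (λ c → Walk G c v (c ∷ post)) (sym a≡b) fromB)
                           (<-trans (n<1+n _) skip)
    where
    toA : Walk G u a (pre ∷ʳ a)
    toA = proj₁ (walk-split pre (m ∷ mid ++ b ∷ post) walk)
    fromB : Walk G b v (b ∷ post)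
    fromB = proj₂ (walk-split (a ∷ m ∷ mid) post (proj₂ (walk-split pre _ walk)))
    skip : length (b ∷ post) < length (m ∷ mid ++ b ∷ post)
    skip = s≤s (length-++-≤ʳ (b ∷ post) {mid})
    shorter : ∀ rest → Walk G a v (a ∷ rest) → length rest < length (m ∷ mid ++ b ∷ post) → ⊥
    shorter rest w lt = <⇒≱ (length-++ˡ-< pre (s≤s lt)) (minimal _ (walk-join pre rest toA w))

  record TrueTwins (x y : Vertex) : Set where
    field
      distinct : x ≢ y
      to       : ∀ {q} → Near q x → Near q y
      from     : ∀ {q} → Near q y → Near q x

  twins-sym : ∀ {x y} → TrueTwins x y → TrueTwins y x
  twins-sym t = record { distinct = distinct ∘ sym ; to = from ; from = to }
    where open TrueTwins t

  twins-adjacent : ∀ {x y} → TrueTwins x y → x ~ y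
  twins-adjacent t with TrueTwins.to t (inj₂ refl)
  ... | inj₁ x~y = x~y
  ... | inj₂ x≡y = ⊥-elim (TrueTwins.distinct t x≡y)

  twins-nothing-before : ∀ {u v x y z} A D → ShortestPath G u v (A ++ x ∷ y ∷ D) →
    TrueTwins x y → z ∉ A
  twins-nothing-before A D sp t z∈A with initLast A
  twins-nothing-before .[] D sp t () | []
  twins-nothing-before {x = x} {y} .(A' ∷ʳ q) D sp t _ | A' ∷ʳ′ q =
    geodesic-no-shortcut A' [] D sp' (TrueTwins.to t (inj₁ (walk-edge A' (y ∷ D) (proj₁ sp'))))
    where
    sp' : ShortestPath G _ _ (A' ++ q ∷ x ∷ y ∷ D)
    sp' = subst (ShortestPath G _ _) (++-assoc A' [ q ] (x ∷ y ∷ D)) sp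

  twins-nothing-after : ∀ {u v x y z} A D → ShortestPath G u v (A ++ x ∷ y ∷ D) →
    TrueTwins x y → z ∉ D
  twins-nothing-after {x = x} {y} A (r ∷ D) sp t _ =
    geodesic-no-shortcut A [] D sp (Near-sym (TrueTwins.from t (inj₁ (~-sym y~r))))
    where
    y~r : y ~ r
    y~r = walk-edge [ x ] D (proj₂ (walk-split A _ (proj₁ sp)))

  geodesic-twins-ordered : ∀ {u v z x y} A C D → ShortestPath G u v (A ++ x ∷ C ++ y ∷ D) →
    TrueTwins x y → z ∈ A ++ x ∷ C ++ y ∷ D → z ≢ x → z ≢ y → ⊥
  geodesic-twins-ordered A (_ ∷ C) D sp t _ _ _ = geodesic-no-shortcut A C D sp (inj₁ (twins-adjacent t))
  geodesic-twins-ordered A [] D sp t z∈ z≢x z≢y with ∈-++⁻ A z∈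
  ... | inj₁ z∈A                 = twins-nothing-before A D sp t z∈A
  ... | inj₂ (here z≡x)          = z≢x z≡x
  ... | inj₂ (there (here z≡y))  = z≢y z≡y
  ... | inj₂ (there (there z∈D)) = twins-nothing-after A D sp t z∈D

  twins-not-collinear : ∀ {x y z} → TrueTwins x y → z ≢ x → z ≢ y → ¬ OnCommonShortestPath G x y z
  twins-not-collinear t z≢x z≢y (_ , _ , _ , sp , x∈ , y∈ , z∈) with ∈-∃++ x∈
  ... | A , B , refl with ∈-++⁻ A y∈
  ... | inj₂ (here y≡x) = TrueTwins.distinct t (sym y≡x)
  ... | inj₂ (there y∈B) with ∈-∃++ y∈B
  ...   | C , D , refl = geodesic-twins-ordered A C D sp t z∈ z≢x z≢y
  twins-not-collinear {x} {y} t z≢x z≢y (_ , _ , _ , sp , x∈ , y∈ , z∈) | A , B , refl | inj₁ y∈A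
    with ∈-∃++ y∈A
  ... | C , E , refl = geodesic-twins-ordered C E B (subst (ShortestPath G _ _) reassoc sp)
                         (twins-sym t) (subst (_ ∈_) reassoc z∈) z≢y z≢x
    where
    reassoc : (C ++ y ∷ E) ++ x ∷ B ≡ C ++ y ∷ E ++ x ∷ B
    reassoc = ++-assoc C (y ∷ E) (x ∷ B)

generalPosition-⊆ : ∀ (G : Graph) {S S'} → S' ⊆ S → GeneralPosition G S → GeneralPosition G S'
generalPosition-⊆ G S'⊆S gp x y z x∈ y∈ z∈ = gp x y z (S'⊆S x∈) (S'⊆S y∈) (S'⊆S z∈)

record InvolutionFixing {n : ℕ} (o : Fin n) : Set where
  field
    flip            : Fin n → Fin n
    flip-involutive : ∀ h → flip (flip h) ≡ h
    flip-fixes      : flip o ≡ o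
    flip-fixed      : ∀ {h} → flip h ≡ h → h ≡ o

record FixedPointFreeInvolution (n : ℕ) : Set where
  field
    swap            : Fin n → Fin n
    swap-involutive : ∀ h → swap (swap h) ≡ h
    swap-no-fixed   : ∀ h → swap h ≢ h

module Lexicographic (G : Graph) (_≟_ : DecidableEquality (Graph.Vertex G)) (n : ℕ) where
  open Graph G

  P : Graph
  P = G ∘ₗ K n

  open Geodesic P using (Near; TrueTwins; geodesic-near-ends; twins-not-collinear)

  fibre : Graph.Vertex P → Vertex
  fibre = proj₁

  sameFibre-near : ∀ {x y} → fibre x ≡ fibre y → Near x y
  sameFibre-near {x} {y} e with proj₂ x Fin.≟ proj₂ y
  ... | yes h≡h' = inj₂ (×-≡,≡→≡ (e , h≡h'))
  ... | no  h≢h' = inj₁ (inj₂ (e , h≢h'))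

  sameFibre-twins : ∀ {x y} → fibre x ≡ fibre y → x ≢ y → TrueTwins x y
  sameFibre-twins e x≢y = record { distinct = x≢y ; to = near-moves e ; from = near-moves (sym e) }
    where
    near-moves : ∀ {x y} → fibre x ≡ fibre y → ∀ {q} → Near q x → Near q y
    near-moves e (inj₁ (inj₁ q~x))      = inj₁ (inj₁ (subst (_ ~_) e q~x))
    near-moves e (inj₁ (inj₂ (e' , _))) = sameFibre-near (trans e' e)
    near-moves e (inj₂ refl)            = sameFibre-near e

  record Projection (u v : Graph.Vertex P) (ws : List (Graph.Vertex P)) : Set where
    field
      path    : List Vertex
      walk    : Walk G (fibre u) (fibre v) path
      shorter : length path ≤ length ws
      covers  : ∀ {w} → w ∈ ws → fibre w ∈ path

  walk-project : ∀ {u v ws} → Walk P u v ws → Projection u v ws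
  walk-project {u} here = record
    { path = [ fibre u ] ; walk = here ; shorter = s≤s z≤n ; covers = λ { (here refl) → here refl } }
  walk-project {u} (step (inj₁ g~g') w) = record
    { path = fibre u ∷ path ; walk = step g~g' walk ; shorter = s≤s shorter
    ; covers = λ { (here refl) → here refl ; (there w∈) → there (covers w∈) } }
    where open Projection (walk-project w)
  walk-project (step (inj₂ (refl , _)) w) = record
    { path = path ; walk = walk ; shorter = m≤n⇒m≤1+n shorter
    ; covers = λ { (here refl) → Geodesic.walk-head G walk ; (there w∈) → covers w∈ } }
    where open Projection (walk-project w)

  walk-lift : ∀ (H : Vertex → Fin n) {a b ws} → Walk G a b ws →
              Walk P (a , H a) (b , H b) (map < id , H > ws)
  walk-lift H here         = here
  walk-lift H (step p w)   = step (inj₁ p) (walk-lift H w)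

  geodesic-lift : ∀ (H : Vertex → Fin n) {a b ws} → ShortestPath G a b ws →
                  ShortestPath P (a , H a) (b , H b) (map < id , H > ws)
  geodesic-lift H {ws = ws} (w , minimal) = walk-lift H w , λ ws' w' →
    let open Projection (walk-project w') in
    ≤-trans (≤-reflexive (length-map < id , H > ws)) (≤-trans (minimal path walk) shorter)

  _[_≔_] : (Vertex → Fin n) → Vertex → Fin n → Vertex → Fin n
  (H [ a ≔ h ]) w with w ≟ a
  ... | yes _ = h
  ... | no  _ = H w

  ≔-same : ∀ H a h → (H [ a ≔ h ]) a ≡ h
  ≔-same H a h with a ≟ a
  ... | yes _   = refl
  ... | no  a≢a = ⊥-elim (a≢a refl)

  ≔-other : ∀ H {a w} h → w ≢ a → (H [ a ≔ h ]) w ≡ H w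
  ≔-other H {a} {w} h w≢a with w ≟ a
  ... | yes w≡a = ⊥-elim (w≢a w≡a)
  ... | no  _   = refl

  geodesic-project : ∀ {u v ws} → fibre u ≢ fibre v → ShortestPath P u v ws →
    ∃ λ ws' → ShortestPath G (fibre u) (fibre v) ws' × (∀ {w} → w ∈ ws → fibre w ∈ ws')
  geodesic-project {g , h} {g' , h'} g≢g' (walk-P , minimal) =
    path ,
    (walk , λ ws' walk' →
      ≤-trans shorter (≤-trans (minimal _ (lifted walk')) (≤-reflexive (length-map _ ws')))) ,
    covers
    where
    open Projection (walk-project walk-P)
    H : Vertex → Fin n
    H = const h' [ g ≔ h ]
    lifted : ∀ {ws'} → Walk G g g' ws' → Walk P (g , h) (g' , h') (map < id , H > ws')
    lifted {ws'} w = subst₂ (λ k k' → Walk P (g , k) (g' , k') (map < id , H > ws'))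
      (≔-same _ g h) (≔-other _ h (g≢g' ∘ sym)) (walk-lift H w)

  collinear-project : ∀ {x y z} → fibre x ≢ fibre y → OnCommonShortestPath P x y z →
    OnCommonShortestPath G (fibre x) (fibre y) (fibre z)
  collinear-project x≢y (u , v , ws , sp , x∈ , y∈ , z∈) with fibre u ≟ fibre v
  ... | no u≢v = let ws' , sp' , covers = geodesic-project u≢v sp in
                 fibre u , fibre v , ws' , sp' , covers x∈ , covers y∈ , covers z∈
  -- A geodesic between two vertices of one fibre has at most two vertices.
  ... | yes u≡v = ⊥-elim (x≢y (trans (inFibre x∈) (sym (inFibre y∈))))
    where
    inFibre : ∀ {w} → w ∈ ws → fibre w ≡ fibre u
    inFibre w∈ with geodesic-near-ends sp (sameFibre-near u≡v) w∈
    ... | inj₁ refl = refl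
    ... | inj₂ refl = sym u≡v

  collinear-lift : ∀ {a b c} ha hb hc → a ≢ b → a ≢ c → b ≢ c → OnCommonShortestPath G a b c →
    OnCommonShortestPath P (a , ha) (b , hb) (c , hc)
  collinear-lift {a} {b} {c} ha hb hc a≢b a≢c b≢c (u , v , ws , sp , a∈ , b∈ , c∈) =
    _ , _ , _ , geodesic-lift H sp ,
    lifted a∈ (≔-same _ a ha) ,
    lifted b∈ (trans (≔-other _ ha (a≢b ∘ sym)) (≔-same _ b hb)) ,
    lifted c∈ (trans (≔-other _ ha (a≢c ∘ sym)) (≔-other _ hb (b≢c ∘ sym)))
    where
    H : Vertex → Fin n
    H = (const hc [ b ≔ hb ]) [ a ≔ ha ]
    lifted : ∀ {w h} → w ∈ ws → H w ≡ h → (w , h) ∈ map < id , H > ws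
    lifted w∈ refl = ∈-map⁺ < id , H > w∈

  generalPosition-fromBase : ∀ {S} → GeneralPosition G (map fibre S) → GeneralPosition P S
  generalPosition-fromBase gp x y z x∈ y∈ z∈ x≢y y≢z x≢z collinear
    with fibre x ≟ fibre y | fibre y ≟ fibre z | fibre x ≟ fibre z
  ... | yes e | _ | _ = twins-not-collinear (sameFibre-twins e x≢y) (x≢z ∘ sym) (y≢z ∘ sym) collinear
  ... | _ | yes e | _ = twins-not-collinear (sameFibre-twins e y≢z) x≢y x≢z (rotate collinear)
    where
    rotate : OnCommonShortestPath P x y z → OnCommonShortestPath P y z x
    rotate (u , v , ws , sp , x∈ , y∈ , z∈) = u , v , ws , sp , y∈ , z∈ , x∈
  ... | _ | _ | yes e = twins-not-collinear (sameFibre-twins e x≢z) (x≢y ∘ sym) y≢z (swap collinear)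
    where
    swap : OnCommonShortestPath P x y z → OnCommonShortestPath P x z y
    swap (u , v , ws , sp , x∈ , y∈ , z∈) = u , v , ws , sp , x∈ , z∈ , y∈
  ... | no a | no b | no c =
    gp _ _ _ (∈-map⁺ fibre x∈) (∈-map⁺ fibre y∈) (∈-map⁺ fibre z∈) a b c
       (collinear-project a collinear)

  generalPosition-toBase : ∀ {S} → GeneralPosition P S → GeneralPosition G (map fibre S)
  generalPosition-toBase gp a b c a∈ b∈ c∈ a≢b b≢c a≢c collinear
    with ∈-map⁻ fibre a∈ | ∈-map⁻ fibre b∈ | ∈-map⁻ fibre c∈
  ... | (_ , ha) , x∈ , refl | (_ , hb) , y∈ , refl | (_ , hc) , z∈ , refl =
    gp _ _ _ x∈ y∈ z∈ (a≢b ∘ cong fibre) (b≢c ∘ cong fibre) (a≢c ∘ cong fibre)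
       (collinear-lift ha hb hc a≢b a≢c b≢c collinear)

  legal-fromBase : ∀ {F S v} → Legal G F (fibre v) → map fibre S ⊆ F → Legal P S v
  legal-fromBase (v∉F , gp) S⊆F =
    (λ v∈S → v∉F (S⊆F (∈-map⁺ fibre v∈S))) ,
    generalPosition-fromBase (generalPosition-⊆ G (∷⁺ʳ _ S⊆F) gp)

  legal-toBase : ∀ {F S v} → Legal P S v → fibre v ∉ F → F ⊆ map fibre S → Legal G F (fibre v)
  legal-toBase (_ , gp) v∉F F⊆S =
    v∉F , generalPosition-⊆ G (∷⁺ʳ _ F⊆S) (generalPosition-toBase gp)

  partner-legal : ∀ {S w r} → Legal P S w → r ∉ w ∷ S → fibre r ≡ fibre w → Legal P (w ∷ S) r
  partner-legal (_ , gp) r∉ e =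
    r∉ ,
    generalPosition-fromBase (generalPosition-⊆ G (∈-∷⁺ʳ (here e) id) (generalPosition-toBase gp))

  module Mirroring (fix : (o : Fin n) → InvolutionFixing o) (h₀ : Fin n) where
    open DecMembership _≟_ using (_∈?_)

    reflect : Graph.Vertex P → Graph.Vertex P → Graph.Vertex P
    reflect o x = fibre x , InvolutionFixing.flip (fix (proj₂ o)) (proj₂ x)

    reflect-involutive : ∀ o x → reflect o (reflect o x) ≡ x
    reflect-involutive o x =
      cong (fibre x ,_) (InvolutionFixing.flip-involutive (fix (proj₂ o)) (proj₂ x))

    reflect-origin : ∀ o → reflect o o ≡ o
    reflect-origin o = cong (fibre o ,_) (InvolutionFixing.flip-fixes (fix (proj₂ o)))

    reflect-fixed : ∀ {o x} → fibre x ≡ fibre o → reflect o x ≡ x → x ≡ o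
    reflect-fixed {o} e r≡x =
      ×-≡,≡→≡ (e , InvolutionFixing.flip-fixed (fix (proj₂ o)) (cong proj₂ r≡x))

    -- O lists the first vertex played in each occupied fibre, most recent first;
    -- map fibre O is then the corresponding position of the game on G.
    record Mirrored (S O : List (Graph.Vertex P)) : Set where
      field
        origins-selected  : O ⊆ S
        fibres-opened     : map fibre S ⊆ map fibre O
        reflection-closed : ∀ {x o} → x ∈ S → o ∈ O → fibre x ≡ fibre o →
                            x ≡ o ⊎ reflect o x ∈ S
        origins-apart     : ∀ {o o'} → o ∈ O → o' ∈ O → fibre o ≡ fibre o' → o ≡ o'
    open Mirrored public

    mirrored-[] : Mirrored [] []
    mirrored-[] = record
      { origins-selected = λ () ; fibres-opened = λ () ; reflection-closed = λ () ; origins-apart = λ () }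

    opened : ∀ {O o g} → o ∈ O → g ≡ fibre o → g ∈ map fibre O
    opened o∈ e = subst (_∈ _) (sym e) (∈-map⁺ fibre o∈)

    mirrored-open : ∀ {S O v} → Mirrored S O → fibre v ∉ map fibre O → Mirrored (v ∷ S) (v ∷ O)
    mirrored-open {S} {O} {v} m new = record
      { origins-selected  = ∷⁺ʳ v (origins-selected m)
      ; fibres-opened     = ∷⁺ʳ (fibre v) (fibres-opened m)
      ; reflection-closed = closed
      ; origins-apart     = apart
      }
      where
      closed : ∀ {x o} → x ∈ v ∷ S → o ∈ v ∷ O → fibre x ≡ fibre o →
               x ≡ o ⊎ reflect o x ∈ v ∷ S
      closed (here refl) (here refl) _  = inj₁ refl
      closed (here refl) (there o∈)  e  = ⊥-elim (new (opened o∈ e))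
      closed (there x∈)  (here refl) e  =
        ⊥-elim (new (subst (_∈ _) e (fibres-opened m (∈-map⁺ fibre x∈))))
      closed (there x∈)  (there o∈)  e  = Sum.map₂ there (reflection-closed m x∈ o∈ e)
      apart : ∀ {o o'} → o ∈ v ∷ O → o' ∈ v ∷ O → fibre o ≡ fibre o' → o ≡ o'
      apart (here refl) (here refl) _   = refl
      apart (here refl) (there o∈)  e   = ⊥-elim (new (opened o∈ e))
      apart (there o∈)  (here refl) e   = ⊥-elim (new (opened o∈ (sym e)))
      apart (there o∈)  (there o'∈) e   = origins-apart m o∈ o'∈ e

    mirrored-reflect : ∀ {S O w o} → Mirrored S O → o ∈ O → fibre w ≡ fibre o →
                       Mirrored (reflect o w ∷ w ∷ S) O
    mirrored-reflect {S} {O} {w} {o} m o∈ e = record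
      { origins-selected  = there ∘ there ∘ origins-selected m
      ; fibres-opened     = ∈-∷⁺ʳ (opened o∈ e) (∈-∷⁺ʳ (opened o∈ e) (fibres-opened m))
      ; reflection-closed = closed
      ; origins-apart     = origins-apart m
      }
      where
      closed : ∀ {x o'} → x ∈ reflect o w ∷ w ∷ S → o' ∈ O → fibre x ≡ fibre o' →
               x ≡ o' ⊎ reflect o' x ∈ reflect o w ∷ w ∷ S
      closed (here refl) o'∈ e' with origins-apart m o∈ o'∈ (trans (sym e) e')
      ... | refl = inj₂ (there (here (reflect-involutive o w)))
      closed (there (here refl)) o'∈ e' with origins-apart m o∈ o'∈ (trans (sym e) e')
      ... | refl = inj₂ (here refl)
      closed (there (there x∈)) o'∈ e' = Sum.map₂ (there ∘ there) (reflection-closed m x∈ o'∈ e')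

    reflect-fresh : ∀ {S O w o} → Mirrored S O → w ∉ S → o ∈ O → fibre w ≡ fibre o →
                    reflect o w ∉ w ∷ S
    reflect-fresh m w∉S o∈ e (here r≡w) =
      w∉S (subst (_∈ _) (sym (reflect-fixed e r≡w)) (origins-selected m o∈))
    reflect-fresh {w = w} {o} m w∉S o∈ e (there r∈S) with reflection-closed m r∈S o∈ e
    ... | inj₁ r≡o = w∉S (subst (_∈ _) (sym w≡o) (origins-selected m o∈))
      where
      w≡o : w ≡ o
      w≡o = begin
        w                       ≡⟨ sym (reflect-involutive o w) ⟩
        reflect o (reflect o w) ≡⟨ cong (reflect o) r≡o ⟩
        reflect o o             ≡⟨ reflect-origin o ⟩
        o                       ∎
        where open ≡-Reasoning
    ... | inj₂ rr∈S = w∉S (subst (_∈ _) (reflect-involutive o w) rr∈S)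

    -- B's strategy on P is played against the moves (g , h₀) of A; whenever it
    -- answers inside an occupied fibre, A's simulated reply is the reflection of
    -- that answer.  The recursion is on the answer functions under allMoves,
    -- which keeps it structural.
    mutual
      toMoveWins-base : ∀ {S O} → Mirrored S O → ToMoveWins P S → ToMoveWins G (map fibre O)
      toMoveWins-base {O = O} m (move w legal (allMoves reply)) =
        answer m w legal reply (fibre w ∈? map fibre O)

      answer : ∀ {S O} → Mirrored S O → ∀ w → Legal P S w →
               (∀ v → Legal P (w ∷ S) v → ToMoveWins P (v ∷ w ∷ S)) →
               Dec (fibre w ∈ map fibre O) → ToMoveWins G (map fibre O)
      answer m w legal reply (no new) =
        move (fibre w) (legal-toBase legal new (map⁺ fibre (origins-selected m)))
          (toMoveLoses-base (mirrored-open m new) reply)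
      answer m w legal reply (yes w-opened) =
        let o , o∈ , e = ∈-map⁻ fibre w-opened in
        toMoveWins-base (mirrored-reflect m o∈ e)
          (reply (reflect o w) (partner-legal legal (reflect-fresh m (proj₁ legal) o∈ e) refl))

      toMoveLoses-base : ∀ {S O} → Mirrored S O → (∀ v → Legal P S v → ToMoveWins P (v ∷ S)) →
                         ToMoveLoses G (map fibre O)
      toMoveLoses-base m reply = allMoves λ g legal →
        toMoveWins-base (mirrored-open m (proj₁ legal))
          (reply (g , h₀) (legal-fromBase legal (fibres-opened m)))

    bWins-base : BWins P → BWins G
    bWins-base (allMoves reply) = toMoveLoses-base mirrored-[] reply

module Countdown {A : Set} (_≟_ : DecidableEquality A) where
  open DecMembership _≟_ using (_∈?_)

  #unselected : List A → List A → ℕ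
  #unselected S []      = 0
  #unselected S (x ∷ L) with x ∈? S
  ... | yes _ = #unselected S L
  ... | no  _ = suc (#unselected S L)

  #unselected-∷-≤ : ∀ {v S} L → #unselected (v ∷ S) L ≤ #unselected S L
  #unselected-∷-≤ []                    = z≤n
  #unselected-∷-≤ {v} {S} (x ∷ L) with x ≟ v | x ∈? S
  ... | yes _ | yes _ = #unselected-∷-≤ L
  ... | yes _ | no  _ = m≤n⇒m≤1+n (#unselected-∷-≤ L)
  ... | no  _ | yes _ = #unselected-∷-≤ L
  ... | no  _ | no  _ = s≤s (#unselected-∷-≤ L)

  #unselected-∷-< : ∀ {v S} L → v ∉ S → v ∈ L → #unselected (v ∷ S) L < #unselected S L
  #unselected-∷-< {v} {S} (x ∷ L) v∉S (here refl) with x ≟ v | x ∈? S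
  ... | _     | yes v∈S = ⊥-elim (v∉S v∈S)
  ... | yes _ | no  _   = s≤s (#unselected-∷-≤ L)
  ... | no v≢v | no _   = ⊥-elim (v≢v refl)
  #unselected-∷-< {v} {S} (x ∷ L) v∉S (there v∈L) with x ≟ v | x ∈? S
  ... | yes _ | yes _ = #unselected-∷-< L v∉S v∈L
  ... | yes _ | no  _ = m≤n⇒m≤1+n (#unselected-∷-< L v∉S v∈L)
  ... | no  _ | yes _ = #unselected-∷-< L v∉S v∈L
  ... | no  _ | no  _ = s≤s (#unselected-∷-< L v∉S v∈L)

finite⇒decidable : ∀ (G : Graph) → Finite G → DecidableEquality (Graph.Vertex G)
finite⇒decidable G (vs , complete) u v =
  map′ (SetoidMembership.index-injective (setoid _) (complete u) (complete v)) (λ { refl → refl })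
       (index (complete u) Fin.≟ index (complete v))

module Strategies (G : Graph) (finite : Finite G) (n : ℕ) where
  open Lexicographic G (finite⇒decidable G finite) n public

  _≟ᴾ_ : DecidableEquality (Graph.Vertex P)
  _≟ᴾ_ = ≡-dec (finite⇒decidable G finite) Fin._≟_

  open Countdown _≟ᴾ_

  vertices : List (Graph.Vertex P)
  vertices = cartesianProduct (proj₁ finite) (allFin n)

  #free : List (Graph.Vertex P) → ℕ
  #free S = #unselected S vertices

  legal-decreases : ∀ {S v} → Legal P S v → #free (v ∷ S) < #free S
  legal-decreases {v = g , h} (v∉S , _) =
    #unselected-∷-< vertices v∉S (∈-cartesianProduct⁺ (proj₂ finite g) (∈-allFin h))

  round-decreases : ∀ {S v w} → Legal P S v → Legal P (v ∷ S) w → #free (w ∷ v ∷ S) < #free S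
  round-decreases lv lw = <-trans (legal-decreases lw) (legal-decreases lv)

  module Even (μ : FixedPointFreeInvolution n) where
    open FixedPointFreeInvolution μ

    mirror : Graph.Vertex P → Graph.Vertex P
    mirror x = fibre x , swap (proj₂ x)

    MirrorClosed : List (Graph.Vertex P) → Set
    MirrorClosed S = ∀ {x} → x ∈ S → mirror x ∈ S

    mirror-involutive : ∀ x → mirror (mirror x) ≡ x
    mirror-involutive x = cong (fibre x ,_) (swap-involutive (proj₂ x))

    mirror-fresh : ∀ {S v} → MirrorClosed S → v ∉ S → mirror v ∉ v ∷ S
    mirror-fresh closed v∉S (here e)  = swap-no-fixed _ (cong proj₂ e)
    mirror-fresh closed v∉S (there m) = v∉S (subst (_∈ _) (mirror-involutive _) (closed m))

    mirrorClosed-∷ : ∀ {S v} → MirrorClosed S → MirrorClosed (mirror v ∷ v ∷ S)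
    mirrorClosed-∷ {v = v} closed (here refl)         = there (here (mirror-involutive v))
    mirrorClosed-∷         closed (there (here refl)) = here refl
    mirrorClosed-∷         closed (there (there x∈))  = there (there (closed x∈))

    toMoveLoses-mirror : ∀ {S} → Acc _<_ (#free S) → MirrorClosed S → ToMoveLoses P S
    toMoveLoses-mirror (acc smaller) closed = allMoves λ v legal →
      let legal′ = partner-legal legal (mirror-fresh closed (proj₁ legal)) refl in
      move (mirror v) legal′
        (toMoveLoses-mirror (smaller (round-decreases legal legal′)) (mirrorClosed-∷ closed))

    bWins-mirror : BWins P
    bWins-mirror = toMoveLoses-mirror (<-wellFounded _) (λ ())

  module Odd (fix : (o : Fin n) → InvolutionFixing o) (h₀ : Fin n) where
    open Mirroring fix h₀ public
    open DecMembership (finite⇒decidable G finite) using (_∈?_)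

    toMoveLoses-lift : ∀ {S O} → Acc _<_ (#free S) → Mirrored S O → ToMoveLoses G (map fibre O) →
                       ToMoveLoses P S
    toMoveLoses-lift {S} {O} (acc smaller) m loses@(allMoves reply) = allMoves respond
      where
      respond : ∀ v → Legal P S v → ToMoveWins P (v ∷ S)
      respond v legal with fibre v ∈? map fibre O
      ... | yes v-opened with ∈-map⁻ fibre v-opened
      ...   | o , o∈ , e = move (reflect o v) legal′
                (toMoveLoses-lift (smaller (round-decreases legal legal′)) (mirrored-reflect m o∈ e) loses)
        where
        legal′ : Legal P (v ∷ S) (reflect o v)
        legal′ = partner-legal legal (reflect-fresh m (proj₁ legal) o∈ e) refl
      respond v legal | no new with reply (fibre v) (legal-toBase legal new (map⁺ fibre (origins-selected m)))
      ... | move g legal-g loses′ = move (g , h₀) legal′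
                (toMoveLoses-lift (smaller (round-decreases legal legal′))
                   (mirrored-open m′ (proj₁ legal-g)) loses′)
        where
        m′ : Mirrored (v ∷ S) (v ∷ O)
        m′ = mirrored-open m new
        legal′ : Legal P (v ∷ S) (g , h₀)
        legal′ = legal-fromBase legal-g (fibres-opened m′)

    bWins-lift : BWins G → BWins P
    bWins-lift = toMoveLoses-lift (<-wellFounded _) mirrored-[]

swapPairs : ∀ q → FixedPointFreeInvolution (q * 2)
swapPairs q = record
  { swap = sw q ; swap-involutive = sw-involutive q ; swap-no-fixed = sw-no-fixed q }
  where
  sw : ∀ q → Fin (q * 2) → Fin (q * 2)
  sw (suc q) zero          = suc zero
  sw (suc q) (suc zero)    = zero
  sw (suc q) (suc (suc i)) = suc (suc (sw q i))

  sw-involutive : ∀ q (h : Fin (q * 2)) → sw q (sw q h) ≡ h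
  sw-involutive (suc q) zero          = refl
  sw-involutive (suc q) (suc zero)    = refl
  sw-involutive (suc q) (suc (suc i)) = cong (λ k → suc (suc k)) (sw-involutive q i)

  sw-no-fixed : ∀ q (h : Fin (q * 2)) → sw q h ≢ h
  sw-no-fixed (suc q) zero          ()
  sw-no-fixed (suc q) (suc zero)    ()
  sw-no-fixed (suc q) (suc (suc i)) e = sw-no-fixed q i (Fin.suc-injective (Fin.suc-injective e))

fixingZero : ∀ q → InvolutionFixing {suc (q * 2)} zero
fixingZero q = record
  { flip = fl ; flip-involutive = fl-involutive ; flip-fixes = refl ; flip-fixed = fl-fixed }
  where
  open FixedPointFreeInvolution (swapPairs q)
  fl : Fin (suc (q * 2)) → Fin (suc (q * 2))
  fl zero    = zero
  fl (suc i) = suc (swap i)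

  fl-involutive : ∀ h → fl (fl h) ≡ h
  fl-involutive zero    = refl
  fl-involutive (suc i) = cong suc (swap-involutive i)

  fl-fixed : ∀ {h} → fl h ≡ h → h ≡ zero
  fl-fixed {zero}  _ = refl
  fl-fixed {suc i} e = ⊥-elim (swap-no-fixed i (Fin.suc-injective e))

conjugate : ∀ {n} (π : Permutation n n) {o} → InvolutionFixing o → InvolutionFixing (π ⟨$⟩ʳ o)
conjugate π {o} inv = record
  { flip            = to ∘ ι ∘ from
  ; flip-involutive = λ h → begin
      to (ι (from (to (ι (from h))))) ≡⟨ cong (to ∘ ι) (inverseˡ π) ⟩
      to (ι (ι (from h)))             ≡⟨ cong to (ι-involutive _) ⟩
      to (from h)                     ≡⟨ inverseʳ π ⟩
      h                               ∎
  ; flip-fixes      = trans (cong (to ∘ ι) (inverseˡ π)) (cong to ι-fixes)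
  ; flip-fixed      = λ {h} e → begin
      h           ≡⟨ sym (inverseʳ π) ⟩
      to (from h) ≡⟨ cong to (ι-fixed (trans (sym (inverseˡ π)) (cong from e))) ⟩
      to o        ∎
  }
  where
  open InvolutionFixing inv
    renaming (flip to ι; flip-involutive to ι-involutive; flip-fixes to ι-fixes; flip-fixed to ι-fixed)
  open ≡-Reasoning
  to from : Fin _ → Fin _
  to   = π ⟨$⟩ʳ_
  from = π ⟨$⟩ˡ_

involutionFixing : ∀ q (o : Fin (suc (q * 2))) → InvolutionFixing o
-- transpose zero o ⟨$⟩ʳ zero reduces to o.
involutionFixing q o = conjugate (transpose zero o) (fixingZero q)

parity : ∀ n → (∃ λ q → n ≡ q * 2) ⊎ (∃ λ q → n ≡ suc (q * 2))
parity zero = inj₁ (0 , refl)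
parity (suc n) with parity n
... | inj₁ (q , refl) = inj₂ (q , refl)
... | inj₂ (q , refl) = inj₁ (suc q , refl)

odd-∤ : ∀ q → ¬ 2 ∣ suc (q * 2)
odd-∤ q 2∣odd with ∣1⇒≡1 (∣m+n∣m⇒∣n (subst (2 ∣_) (+-comm 1 (q * 2)) 2∣odd) (n∣m*n q))
... | ()

theorem4p3 : (G : Graph) → Finite G → Connected G → (n : ℕ) → 1 ≤ n →
    (BWins (G ∘ₗ K n) → BWins G ⊎ 2 ∣ n) × (BWins G ⊎ 2 ∣ n → BWins (G ∘ₗ K n))
theorem4p3 G finite _ n _ with parity n
... | inj₁ (q , refl) = (λ _ → inj₂ (n∣m*n q)) , (λ _ → bWins-mirror)
  where open Strategies G finite (q * 2)
        open Even (swapPairs q)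
... | inj₂ (q , refl) = inj₁ ∘ bWins-base , [ bWins-lift , ⊥-elim ∘ odd-∤ q ]′
  where open Strategies G finite (suc (q * 2))
        open Odd (involutionFixing q) zero
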